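{- Let $\mathbf{P}=\langle P,\le,\cdot,1\rangle$ be a partially ordered monoid and let $\mathbf{L}$ be a join-completion of the partially ordered set $\langle P,\le\rangle$, regarded as a subset of $\mathcal{L}(\mathbf{P})$ containing $P$ (with the order given by inclusion). The following statements are equivalent: (i) $\mathbf{L}$ can be given a structure of a residuated lattice whose multiplication extends the multiplication of $\mathbf{P}$; (ii) for all $a\in P$ and $b\in L$, $a\backslash_{\mathcal{L}(\mathbf{P})} b\in L$ and $b/_{\mathcal{L}(\mathbf{P})} a\in L$; (iii) $L$ is a nucleus-system of $\mathcal{L}(\mathbf{P})$; (iv) the closure operator $\gamma_L$ associated with $L$ is a nucleus on $\mathcal{L}(\mathbf{P})$. Furthermore, whenever these conditions hold, the multiplication on $\mathbf{L}$ is uniquely determined and the inclusion map $\mathbf{P}\hookrightarrow\mathbf{L}$ preserves, in addition to multiplication, all existing residuals and all existing meets.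
   Context: A partially ordered monoid (pomonoid) is a monoid with a partial order such that multiplication is order-preserving in both arguments. A residuated lattice is an algebra $\langle L,\wedge,\vee,\cdot,\backslash,/,1\rangle$ where $\langle L,\wedge,\vee\rangle$ is a lattice, $\langle L,\cdot,1\rangle$ a monoid, and $xy\le z\iff y\le x\backslash z\iff x\le z/y$ for all $x,y,z$. For a poset $\mathbf{P}$, $\mathcal{L}(\mathbf{P})$ is the set of all order-ideals (down-sets) of $\mathbf{P}$; each $p\in P$ is identified with ${\downarrow}p=\{q\mid q\le p\}$. A join-completion of $\langle P,\le\rangle$ is a complete lattice containing $P$, whose order restricts to that of $P$, in which every element is a join of elements of $P$; every join-completion is isomorphic, via $x\mapsto {\downarrow}x\cap P$, to a subset of $\mathcal{L}(\mathbf{P})$ containing $P$. For a pomonoid $\mathbf{P}$, $\mathcal{L}(\mathbf{P})$ is a residuated lattice with meet $\cap$, join $\cup$, product $X\circ Y={\downarrow}\{xy\mid x\in X,y\in Y\}$, residuals $X\backslash Y=\{z\in P\mid xz\in Y\ \forall x\in X\}$, $Y/X=\{z\in P\mid zx\in Y\ \forall x\in X\}$, unit ${\downarrow}1$; note ${\downarrow}x\circ{\downarrow}y={\downarrow}(xy)$. A closure system of a poset $\mathbf{K}$ is a subset $C$ such that $\gamma_C(x)=\min\{c\in C\mid x\le c\}$ exists for every $x$; $\gamma_C$ is its closure operator. A nucleus on a pomonoid is a closure operator $\gamma$ (order-preserving, $x\le\gamma(x)$, $\gamma\gamma=\gamma$) with $\gamma(a)\gamma(b)\le\gamma(ab)$.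 A nucleus-system of a residuated pomonoid (or residuated lattice) $\mathbf{K}$ is a closure system $C$ with $x\backslash a\in C$ and $a/x\in C$ for all $x\in K$, $a\in C$. -}

module Defs where

open import Level using (0ℓ; Lift) renaming (suc to lsuc)
open import Data.Product using (Σ; Σ-syntax; _×_; _,_; proj₁; proj₂)
open import Relation.Binary.Bundles using (Poset)
open import Algebra.Structures using (IsMonoid)
open import Function.Bundles using (_⇔_)

record Pomonoid : Set₁ where
  field
    poset : Poset 0ℓ 0ℓ 0ℓ
  open Poset poset public
  infixl 7 _∙_
  field
    _∙_      : Carrier → Carrier → Carrier
    ε        : Carrier
    isMonoid : IsMonoid _≈_ _∙_ ε
    ∙-mono   : ∀ {x y u v} → x ≤ y → u ≤ v → (x ∙ u) ≤ (y ∙ v)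

module _ (P : Pomonoid) where
  open Pomonoid P

  SubP : Set₁
  SubP = Carrier → Set

  -- order-ideals (down-sets) of P: the elements of 𝓛(P)
  IsDown : SubP → Set
  IsDown X = ∀ {x y} → y ≤ x → X x → X y

  DS : Set₁
  DS = Σ SubP IsDown

  _⊆_ : DS → DS → Set
  X ⊆ Y = ∀ x → proj₁ X x → proj₁ Y x

  _≐_ : DS → DS → Set
  X ≐ Y = (X ⊆ Y) × (Y ⊆ X)

  -- principal down-set ↓p (the identification of p with ↓p)
  ↓ : Carrier → DS
  ↓ p = (λ q → q ≤ p) , (λ y≤x x≤p → trans y≤x x≤p)

  _∘_ : DS → DS → DS
  X ∘ Y = (λ z → Σ[ x ∈ Carrier ] Σ[ y ∈ Carrier ]
                   (proj₁ X x × proj₁ Y y × z ≤ (x ∙ y)))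
        , (λ { w≤z (x , y , Xx , Yy , z≤xy) → x , y , Xx , Yy , trans w≤z z≤xy })

  _\\_ : DS → DS → DS
  X \\ Y = (λ z → ∀ x → proj₁ X x → proj₁ Y (x ∙ z))
         , (λ w≤z h x Xx → proj₂ Y (∙-mono refl w≤z) (h x Xx))

  _//_ : DS → DS → DS
  Y // X = (λ z → ∀ x → proj₁ X x → proj₁ Y (z ∙ x))
         , (λ w≤z h x Xx → proj₂ Y (∙-mono w≤z refl) (h x Xx))

  SubL : Set₂
  SubL = DS → Set₁

  IsUB : SubL → SubL → DS → Set₁
  IsUB L S u = L u × (∀ X → S X → X ⊆ u)

  IsLB : SubL → SubL → DS → Set₁
  IsLB L S u = L u × (∀ X → S X → u ⊆ X)

  IsSupIn : SubL → SubL → DS → Set₁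
  IsSupIn L S s = IsUB L S s × (∀ u → IsUB L S u → s ⊆ u)

  IsInfIn : SubL → SubL → DS → Set₁
  IsInfIn L S m = IsLB L S m × (∀ u → IsLB L S u → u ⊆ m)

  PrincipalsOf : SubP → SubL
  PrincipalsOf A Y = Lift (lsuc 0ℓ) (Σ[ p ∈ Carrier ] (A p × Y ≐ ↓ p))

  PrincipalsBelow : DS → SubL
  PrincipalsBelow X = PrincipalsOf (proj₁ X)

  -- A join-completion of ⟨P,≤⟩, regarded as a subset L of 𝓛(P):
  -- L is a set of down-sets (closed under the equality of 𝓛(P)),
  -- contains P, (L,⊆) is a complete lattice, and every element of L is a
  -- join (in L) of elements of P.
  record IsJoinCompletion (L : SubL) : Set₂ where
    field
      respects   : ∀ {X Y} → X ≐ Y → L X → L Y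
      contains-P : ∀ p → L (↓ p)
      complete   : ∀ (S : SubL) → (∀ X → S X → L X) →
                   Σ[ s ∈ DS ] IsSupIn L S s
      join-dense : ∀ X → L X →
                   Σ[ A ∈ SubP ] IsSupIn L (PrincipalsOf A) X

  -- (i) A residuated-lattice structure on L (with its lattice order being
  -- inclusion) whose multiplication extends the multiplication of P.
  -- Operations are given on elements of L and must respect ≐.
  record RLStructureOn (L : SubL) (J : IsJoinCompletion L) : Set₁ where
    open IsJoinCompletion J using () renaming (contains-P to contains-P-of)
    field
      mul   : ∀ X Y → L X → L Y → DS
      mul-L : ∀ X Y (lx : L X) (ly : L Y) → L (mul X Y lx ly)
      mul-cong : ∀ {X X' Y Y'} (lx : L X) (lx' : L X') (ly : L Y) (ly' : L Y') →
                 X ≐ X' → Y ≐ Y' → mul X Y lx ly ≐ mul X' Y' lx' ly'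
      unit  : DS
      unit-L : L unit
      assoc : ∀ X Y Z (lx : L X) (ly : L Y) (lz : L Z) →
              mul (mul X Y lx ly) Z (mul-L X Y lx ly) lz
                ≐ mul X (mul Y Z ly lz) lx (mul-L Y Z ly lz)
      unit-l : ∀ X (lx : L X) → mul unit X unit-L lx ≐ X
      unit-r : ∀ X (lx : L X) → mul X unit lx unit-L ≐ X
      ldiv  : ∀ X Y → L X → L Y → DS
      ldiv-L : ∀ X Y (lx : L X) (ly : L Y) → L (ldiv X Y lx ly)
      rdiv  : ∀ Y X → L Y → L X → DS
      rdiv-L : ∀ Y X (ly : L Y) (lx : L X) → L (rdiv Y X ly lx)
      resid-l : ∀ X Y Z (lx : L X) (ly : L Y) (lz : L Z) →
                (mul X Y lx ly ⊆ Z) ⇔ (Y ⊆ ldiv X Z lx lz)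
      resid-r : ∀ X Y Z (lx : L X) (ly : L Y) (lz : L Z) →
                (mul X Y lx ly ⊆ Z) ⇔ (X ⊆ rdiv Z Y lz ly)
      extends : ∀ a b → mul (↓ a) (↓ b) (contains-P-of a) (contains-P-of b) ≐ ↓ (a ∙ b)

  Cond-ii : SubL → Set₁
  Cond-ii L = ∀ a B → L B → L (↓ a \\ B) × L (B // ↓ a)

  IsLeastAbove : SubL → DS → DS → Set₁
  IsLeastAbove L X c = L c × X ⊆ c × (∀ d → L d → X ⊆ d → c ⊆ d)

  IsClosureSystem : SubL → Set₁
  IsClosureSystem L = ∀ X → Σ[ c ∈ DS ] IsLeastAbove L X c

  IsNucleusSystem : SubL → Set₁
  IsNucleusSystem L = IsClosureSystem L ×
                      (∀ X A → L A → L (X \\ A) × L (A // X))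

  IsClosureOperatorOf : SubL → (DS → DS) → Set₁
  IsClosureOperatorOf L γ = ∀ X → IsLeastAbove L X (γ X)

  record IsNucleus (γ : DS → DS) : Set₁ where
    field
      monotone  : ∀ X Y → X ⊆ Y → γ X ⊆ γ Y
      extensive : ∀ X → X ⊆ γ X
      idempotent : ∀ X → γ (γ X) ≐ γ X
      multiplicative : ∀ X Y → (γ X ∘ γ Y) ⊆ γ (X ∘ Y)

  Cond-iv : SubL → Set₁
  Cond-iv L = Σ[ γ ∈ (DS → DS) ] (IsClosureOperatorOf L γ × IsNucleus γ)

  IsLResidualInP : Carrier → Carrier → Carrier → Set
  IsLResidualInP a b c = (a ∙ c) ≤ b × (∀ z → (a ∙ z) ≤ b → z ≤ c)

  IsRResidualInP : Carrier → Carrier → Carrier → Set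
  IsRResidualInP b a c = (c ∙ a) ≤ b × (∀ z → (z ∙ a) ≤ b → z ≤ c)

  IsMeetInP : SubP → Carrier → Set
  IsMeetInP A m = (∀ x → A x → m ≤ x) × (∀ z → (∀ x → A x → z ≤ x) → z ≤ m)

  PreservesResidualsAndMeets : (L : SubL) (J : IsJoinCompletion L) → RLStructureOn L J → Set₁
  PreservesResidualsAndMeets L J R =
      (∀ a b c → IsLResidualInP a b c →
         ↓ c ≐ ldiv (↓ a) (↓ b) (contains-P-of a) (contains-P-of b))
    × (∀ b a c → IsRResidualInP b a c →
         ↓ c ≐ rdiv (↓ b) (↓ a) (contains-P-of b) (contains-P-of a))
    × (∀ (A : SubP) m → IsMeetInP A m → IsInfIn L (PrincipalsOf A) (↓ m))
    where open RLStructureOn R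
          open IsJoinCompletion J using () renaming (contains-P to contains-P-of)

  SameMultiplication : (L : SubL) (J : IsJoinCompletion L) → RLStructureOn L J → RLStructureOn L J → Set₁
  SameMultiplication L J R₁ R₂ =
    ∀ X Y (lx : L X) (ly : L Y) →
      RLStructureOn.mul R₁ X Y lx ly ≐ RLStructureOn.mul R₂ X Y lx ly

module Submission where

open import Defs
open import Data.Product using (_×_; Σ; Σ-syntax; _,_; proj₁; proj₂)
open import Function.Bundles using (_⇔_; mk⇔; Equivalence)
open import Level using (Lift; lift)
open import Algebra.Structures using (IsMonoid)
open import Relation.Unary.Properties using (⊆′-refl; ⊆′-trans; ≐′-refl; ≐′-sym; ≐′-trans)

-- Being a complete lattice of down-sets that contains every ↓p, L is closed under
-- arbitrary intersections; since X \ A = ⋂_{x ∈ X} (↓x \ A), condition (ii) already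
-- makes L closed under all residuals of 𝓛(P).  Residual-closure is exactly what
-- makes γ_L multiplicative, and a nucleus γ turns L into a residuated lattice with
-- product γ(X ∘ Y) and the residuals of 𝓛(P).  Conversely, in any residuated
-- structure on L extending P, residuating against principal ideals shows
-- z ∈ ↓a \ B iff az ∈ B, which gives (ii), the preservation of residuals, and
-- that the product of X and Y is the least element of L above X ∘ Y, hence unique.

module Ideals (P : Pomonoid) where
  open Pomonoid P
  open IsMonoid isMonoid using (identityˡ; identityʳ) renaming (assoc to ∙-assoc)

  infix  4 _∈_ _⊑_ _≋_
  infixl 7 _·_
  infix  8 _⧵_ _⁄_

  𝓛 : Set₁
  𝓛 = DS P

  _∈_ : Carrier → 𝓛 → Set
  x ∈ X = proj₁ X x

  _⊑_ _≋_ : 𝓛 → 𝓛 → Set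
  _⊑_ = _⊆_ P
  _≋_ = _≐_ P

  _·_ _⧵_ _⁄_ : 𝓛 → 𝓛 → 𝓛
  _·_ = _∘_ P
  _⧵_ = _\\_ P
  _⁄_ = _//_ P

  ⇓ : Carrier → 𝓛
  ⇓ = ↓ P

  ∈-down : ∀ X {x y} → y ≤ x → x ∈ X → y ∈ X
  ∈-down X = proj₂ X

  ↓-⊑ : ∀ X {x} → x ∈ X → ⇓ x ⊑ X
  ↓-⊑ X x∈X y y≤x = ∈-down X y≤x x∈X

  ·⊑⇒⊑⧵ : ∀ X Y Z → X · Y ⊑ Z → Y ⊑ X ⧵ Z
  ·⊑⇒⊑⧵ X Y Z XY⊑Z y y∈Y x x∈X = XY⊑Z (x ∙ y) (x , y , x∈X , y∈Y , refl)

  ⊑⧵⇒·⊑ : ∀ X Y Z → Y ⊑ X ⧵ Z → X · Y ⊑ Z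
  ⊑⧵⇒·⊑ X Y Z Y⊑X⧵Z w (x , y , x∈X , y∈Y , w≤xy) = ∈-down Z w≤xy (Y⊑X⧵Z y y∈Y x x∈X)

  ·⊑⇒⊑⁄ : ∀ X Y Z → X · Y ⊑ Z → X ⊑ Z ⁄ Y
  ·⊑⇒⊑⁄ X Y Z XY⊑Z x x∈X y y∈Y = XY⊑Z (x ∙ y) (x , y , x∈X , y∈Y , refl)

  ⊑⁄⇒·⊑ : ∀ X Y Z → X ⊑ Z ⁄ Y → X · Y ⊑ Z
  ⊑⁄⇒·⊑ X Y Z X⊑Z⁄Y w (x , y , x∈X , y∈Y , w≤xy) = ∈-down Z w≤xy (X⊑Z⁄Y x x∈X y y∈Y)

  -- X ⊑ Y unfolds to proj₁ X ⊆′ proj₁ Y, which mentions only the predicates of X and Y;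
  -- implicit down-sets therefore have to be supplied by hand.
  ·-mono : ∀ {X X′ Y Y′} → X ⊑ X′ → Y ⊑ Y′ → X · Y ⊑ X′ · Y′
  ·-mono X⊑X′ Y⊑Y′ w (x , y , x∈X , y∈Y , w≤xy) = x , y , X⊑X′ x x∈X , Y⊑Y′ y y∈Y , w≤xy

  ·-cong : ∀ {X X′ Y Y′} → X ≋ X′ → Y ≋ Y′ → X · Y ≋ X′ · Y′
  ·-cong {X} {X′} {Y} {Y′} (X⊑X′ , X′⊑X) (Y⊑Y′ , Y′⊑Y) =
    ·-mono {X} {X′} {Y} {Y′} X⊑X′ Y⊑Y′ , ·-mono {X′} {X} {Y′} {Y} X′⊑X Y′⊑Y

  ·-assoc : ∀ X Y Z → (X · Y) · Z ≋ X · (Y · Z)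
  ·-assoc X Y Z =
      (λ { w (u , z , (x , y , x∈X , y∈Y , u≤xy) , z∈Z , w≤uz) →
           x , y ∙ z , x∈X , (y , z , y∈Y , z∈Z , refl) ,
           trans w≤uz (trans (∙-mono u≤xy refl) (reflexive (∙-assoc x y z))) })
    , (λ { w (x , v , x∈X , (y , z , y∈Y , z∈Z , v≤yz) , w≤xv) →
           x ∙ y , z , (x , y , x∈X , y∈Y , refl) , z∈Z ,
           trans w≤xv (trans (∙-mono refl v≤yz) (reflexive (Eq.sym (∙-assoc x y z)))) })

  ·-identityˡ : ∀ X → ⇓ ε · X ≋ X
  ·-identityˡ X =
      (λ { w (e , x , e≤ε , x∈X , w≤ex) →
           ∈-down X (trans w≤ex (trans (∙-mono e≤ε refl) (reflexive (identityˡ x)))) x∈X })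
    , (λ w w∈X → ε , w , refl , w∈X , reflexive (Eq.sym (identityˡ w)))

  ·-identityʳ : ∀ X → X · ⇓ ε ≋ X
  ·-identityʳ X =
      (λ { w (x , e , x∈X , e≤ε , w≤xe) →
           ∈-down X (trans w≤xe (trans (∙-mono refl e≤ε) (reflexive (identityʳ x)))) x∈X })
    , (λ w w∈X → w , ε , w∈X , refl , reflexive (Eq.sym (identityʳ w)))

  ↓-homo : ∀ a b → ⇓ a · ⇓ b ≋ ⇓ (a ∙ b)
  ↓-homo a b = (λ { w (x , y , x≤a , y≤b , w≤xy) → trans w≤xy (∙-mono x≤a y≤b) })
             , (λ w w≤ab → a , b , refl , refl , w≤ab)

  ↓-preserves-⧵ : ∀ {a b c} → IsLResidualInP P a b c → ⇓ c ≋ ⇓ a ⧵ ⇓ b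
  ↓-preserves-⧵ (ac≤b , c-greatest) =
      (λ z z≤c x x≤a → trans (∙-mono x≤a z≤c) ac≤b)
    , (λ z az∈↓b → c-greatest z (az∈↓b _ refl))

  ↓-preserves-⁄ : ∀ {b a c} → IsRResidualInP P b a c → ⇓ c ≋ ⇓ b ⁄ ⇓ a
  ↓-preserves-⁄ (ca≤b , c-greatest) =
      (λ z z≤c x x≤a → trans (∙-mono z≤c x≤a) ca≤b)
    , (λ z za∈↓b → c-greatest z (za∈↓b _ refl))

  ⋂ : {I : Set} → (I → 𝓛) → 𝓛
  ⋂ F = (λ z → ∀ i → z ∈ F i) , (λ z≤w z∈F i → ∈-down (F i) z≤w (z∈F i))

  ⧵-as-⋂ : ∀ X A → X ⧵ A ≋ ⋂ (λ (x : Σ Carrier (_∈ X)) → ⇓ (proj₁ x) ⧵ A)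
  ⧵-as-⋂ X A = (λ z z∈X⧵A (x , x∈X) y y≤x → ∈-down A (∙-mono y≤x refl) (z∈X⧵A x x∈X))
             , (λ z z∈⋂ x x∈X → z∈⋂ (x , x∈X) x refl)

  ⁄-as-⋂ : ∀ X A → A ⁄ X ≋ ⋂ (λ (x : Σ Carrier (_∈ X)) → A ⁄ ⇓ (proj₁ x))
  ⁄-as-⋂ X A = (λ z z∈A⁄X (x , x∈X) y y≤x → ∈-down A (∙-mono refl y≤x) (z∈A⁄X x x∈X))
             , (λ z z∈⋂ x x∈X → z∈⋂ (x , x∈X) x refl)

  IsResidualClosed : SubL P → Set₁
  IsResidualClosed L = ∀ X A → L A → L (X ⧵ A) × L (A ⁄ X)

  leastAbove-unique : ∀ {L} X {c d} → IsLeastAbove P L X c → IsLeastAbove P L X d → c ≋ d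
  leastAbove-unique _ (c∈L , X⊑c , c-least) (d∈L , X⊑d , d-least) =
    c-least _ d∈L X⊑d , d-least _ c∈L X⊑c

module Completion (P : Pomonoid) (L : SubL P) (J : IsJoinCompletion P L) where
  open Pomonoid P
  open Ideals P
  open IsJoinCompletion J

  infimum : (S : SubL P) → (∀ X → S X → L X) → Σ 𝓛 (IsInfIn P L S)
  infimum S S⊆L with complete (IsLB P L S) (λ _ → proj₁)
  ... | s , (s∈L , s-ub) , s-least =
    s , (s∈L , λ X X∈S → s-least X (S⊆L X X∈S , λ _ lb → proj₂ lb X X∈S)) , s-ub

  ∈-infimum : ∀ {S s z} → IsInfIn P L S s → (∀ Y → S Y → z ∈ Y) → z ∈ s
  ∈-infimum {z = z} (_ , s-greatest) z∈S =
    s-greatest (⇓ z) (contains-P z , λ Y Y∈S → ↓-⊑ Y (z∈S Y Y∈S)) z refl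

  ⋂-closed : {I : Set} (F : I → 𝓛) → (∀ i → L (F i)) → L (⋂ F)
  ⋂-closed {I} F F∈L = respects (s⊑⋂F , ⋂F⊑s) (proj₁ (proj₁ s-inf))
    where
    Image : SubL P
    Image Y = Lift _ (Σ[ i ∈ I ] Y ≋ F i)

    Image⊆L : ∀ Y → Image Y → L Y
    Image⊆L Y (lift (i , Y≋Fi)) = respects (≐′-sym Y≋Fi) (F∈L i)

    s : 𝓛
    s = proj₁ (infimum Image Image⊆L)

    s-inf : IsInfIn P L Image s
    s-inf = proj₂ (infimum Image Image⊆L)

    s⊑⋂F : s ⊑ ⋂ F
    s⊑⋂F z z∈s i = proj₂ (proj₁ s-inf) (F i) (lift (i , ≐′-refl)) z z∈s

    ⋂F⊑s : ⋂ F ⊑ s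
    ⋂F⊑s z z∈⋂F = ∈-infimum s-inf λ { Y (lift (i , Y≋Fi)) → proj₂ Y≋Fi z (z∈⋂F i) }

  closureSystem : IsClosureSystem P L
  closureSystem X = c , proj₁ (proj₁ c-inf) , X⊑c , λ D D∈L X⊑D → proj₂ (proj₁ c-inf) D (D∈L , X⊑D)
    where
    LAbove : SubL P
    LAbove D = L D × X ⊑ D

    c : 𝓛
    c = proj₁ (infimum LAbove (λ _ → proj₁))

    c-inf : IsInfIn P L LAbove c
    c-inf = proj₂ (infimum LAbove (λ _ → proj₁))

    X⊑c : X ⊑ c
    X⊑c x x∈X = ∈-infimum c-inf λ _ (_ , X⊑D) → X⊑D x x∈X

  ↓-preserves-meets : ∀ A m → IsMeetInP P A m → IsInfIn P L (PrincipalsOf P A) (⇓ m)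
  ↓-preserves-meets A m (m-lb , m-greatest) =
      (contains-P m , λ { X (lift (p , p∈A , X≋↓p)) z z≤m → proj₂ X≋↓p z (trans z≤m (m-lb p p∈A)) })
    , λ U (_ , U-lb) z z∈U → m-greatest z λ x x∈A → U-lb (⇓ x) (lift (x , x∈A , ≐′-refl)) z z∈U

  Cond-ii⇒IsNucleusSystem : Cond-ii P L → IsNucleusSystem P L
  Cond-ii⇒IsNucleusSystem ii = closureSystem , λ X A A∈L →
      respects (≐′-sym (⧵-as-⋂ X A)) (⋂-closed _ λ (x , _) → proj₁ (ii x A A∈L))
    , respects (≐′-sym (⁄-as-⋂ X A)) (⋂-closed _ λ (x , _) → proj₂ (ii x A A∈L))

module ClosureOperator (P : Pomonoid) (L : SubL P) (γ : DS P → DS P)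
                       (γ-closure : IsClosureOperatorOf P L γ) where
  open Ideals P

  γ-L : ∀ X → L (γ X)
  γ-L X = proj₁ (γ-closure X)

  γ-extensive : ∀ X → X ⊑ γ X
  γ-extensive X = proj₁ (proj₂ (γ-closure X))

  γ-least : ∀ X {D} → L D → X ⊑ D → γ X ⊑ D
  γ-least X = proj₂ (proj₂ (γ-closure X)) _

  γ-monotone : ∀ X Y → X ⊑ Y → γ X ⊑ γ Y
  γ-monotone X Y X⊑Y = γ-least X (γ-L Y) (⊆′-trans X⊑Y (γ-extensive Y))

  γ-cong : ∀ {X Y} → X ≋ Y → γ X ≋ γ Y
  γ-cong {X} {Y} (X⊑Y , Y⊑X) = γ-monotone X Y X⊑Y , γ-monotone Y X Y⊑X

  γ-fixes-L : ∀ {X} → L X → γ X ≋ X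
  γ-fixes-L {X} X∈L = γ-least X X∈L ⊆′-refl , γ-extensive X

  residualClosed⇒multiplicative : IsResidualClosed L → ∀ X Y → γ X · γ Y ⊑ γ (X · Y)
  residualClosed⇒multiplicative closed X Y = ⊑⧵⇒·⊑ (γ X) (γ Y) G γY⊑γX⧵G
    where
    G : 𝓛
    G = γ (X · Y)

    γX⊑G⁄Y : γ X ⊑ G ⁄ Y
    γX⊑G⁄Y = γ-least X (proj₂ (closed Y G (γ-L _))) (·⊑⇒⊑⁄ X Y G (γ-extensive (X · Y)))

    γY⊑γX⧵G : γ Y ⊑ γ X ⧵ G
    γY⊑γX⧵G = γ-least Y (proj₁ (closed (γ X) G (γ-L _)))
                (·⊑⇒⊑⧵ (γ X) Y G (⊑⁄⇒·⊑ (γ X) Y G γX⊑G⁄Y))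

  residualClosed⇒isNucleus : IsResidualClosed L → IsNucleus P γ
  residualClosed⇒isNucleus closed = record
    { monotone       = γ-monotone
    ; extensive      = γ-extensive
    ; idempotent     = λ X → γ-fixes-L (γ-L X)
    ; multiplicative = residualClosed⇒multiplicative closed
    }

  module _ (nucleus : IsNucleus P γ) where
    open IsNucleus nucleus using (multiplicative)

    γ-absorbˡ : ∀ X Y → γ (γ X · Y) ≋ γ (X · Y)
    γ-absorbˡ X Y =
        γ-least (γ X · Y) (γ-L _)
          (⊆′-trans (·-mono {γ X} {γ X} {Y} {γ Y} ⊆′-refl (γ-extensive Y)) (multiplicative X Y))
      , γ-monotone _ _ (·-mono {X} {γ X} {Y} {Y} (γ-extensive X) ⊆′-refl)

    γ-absorbʳ : ∀ X Y → γ (X · γ Y) ≋ γ (X · Y)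
    γ-absorbʳ X Y =
        γ-least (X · γ Y) (γ-L _)
          (⊆′-trans (·-mono {X} {γ X} {γ Y} {γ Y} (γ-extensive X) ⊆′-refl) (multiplicative X Y))
      , γ-monotone _ _ (·-mono {X} {X} {Y} {γ Y} ⊆′-refl (γ-extensive Y))

    γ-⧵-deflationary : ∀ X {Y} → L Y → γ (X ⧵ Y) ⊑ X ⧵ Y
    γ-⧵-deflationary X {Y} Y∈L = ·⊑⇒⊑⧵ X (γ (X ⧵ Y)) Y
      (⊆′-trans (·-mono {X} {γ X} {γ (X ⧵ Y)} {γ (X ⧵ Y)} (γ-extensive X) ⊆′-refl)
      (⊆′-trans (multiplicative X (X ⧵ Y))
                (γ-least _ Y∈L (⊑⧵⇒·⊑ X (X ⧵ Y) Y ⊆′-refl))))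

    γ-⁄-deflationary : ∀ X {Y} → L Y → γ (Y ⁄ X) ⊑ Y ⁄ X
    γ-⁄-deflationary X {Y} Y∈L = ·⊑⇒⊑⁄ (γ (Y ⁄ X)) X Y
      (⊆′-trans (·-mono {γ (Y ⁄ X)} {γ (Y ⁄ X)} {X} {γ X} ⊆′-refl (γ-extensive X))
      (⊆′-trans (multiplicative (Y ⁄ X) X)
                (γ-least _ Y∈L (⊑⁄⇒·⊑ (Y ⁄ X) X Y ⊆′-refl))))

module NucleusStructure (P : Pomonoid) (L : SubL P) (J : IsJoinCompletion P L)
                        (γ : DS P → DS P) (γ-closure : IsClosureOperatorOf P L γ)
                        (nucleus : IsNucleus P γ) where
  open Pomonoid P using (_∙_; ε)
  open Ideals P
  open IsJoinCompletion J
  open ClosureOperator P L γ γ-closure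

  ⧵-closed : ∀ X {Y} → L Y → L (X ⧵ Y)
  ⧵-closed X Y∈L = respects (γ-⧵-deflationary nucleus X Y∈L , γ-extensive _) (γ-L _)

  ⁄-closed : ∀ X {Y} → L Y → L (Y ⁄ X)
  ⁄-closed X Y∈L = respects (γ-⁄-deflationary nucleus X Y∈L , γ-extensive _) (γ-L _)

  γ-·-assoc : ∀ X Y Z → γ (γ (X · Y) · Z) ≋ γ (X · γ (Y · Z))
  γ-·-assoc X Y Z =
    ≐′-trans (γ-absorbˡ nucleus (X · Y) Z)
    (≐′-trans (γ-cong (·-assoc X Y Z))
              (≐′-sym (γ-absorbʳ nucleus X (Y · Z))))

  residuatedLattice : RLStructureOn P L J
  residuatedLattice = record
    { mul      = λ X Y _ _ → γ (X · Y)
    ; mul-L    = λ X Y _ _ → γ-L (X · Y)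
    ; mul-cong = λ {X} {X′} {Y} {Y′} _ _ _ _ X≋X′ Y≋Y′ → γ-cong (·-cong {X} {X′} {Y} {Y′} X≋X′ Y≋Y′)
    ; unit     = ⇓ ε
    ; unit-L   = contains-P ε
    ; assoc    = λ X Y Z _ _ _ → γ-·-assoc X Y Z
    ; unit-l   = λ X X∈L → ≐′-trans (γ-cong (·-identityˡ X)) (γ-fixes-L X∈L)
    ; unit-r   = λ X X∈L → ≐′-trans (γ-cong (·-identityʳ X)) (γ-fixes-L X∈L)
    ; ldiv     = λ X Y _ _ → X ⧵ Y
    ; ldiv-L   = λ X Y _ Y∈L → ⧵-closed X Y∈L
    ; rdiv     = λ Y X _ _ → Y ⁄ X
    ; rdiv-L   = λ Y X Y∈L _ → ⁄-closed X Y∈L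
    ; resid-l  = λ X Y Z _ _ Z∈L →
        mk⇔ (λ γXY⊑Z → ·⊑⇒⊑⧵ X Y Z (⊆′-trans (γ-extensive (X · Y)) γXY⊑Z))
            (λ Y⊑X⧵Z → γ-least (X · Y) Z∈L (⊑⧵⇒·⊑ X Y Z Y⊑X⧵Z))
    ; resid-r  = λ X Y Z _ _ Z∈L →
        mk⇔ (λ γXY⊑Z → ·⊑⇒⊑⁄ X Y Z (⊆′-trans (γ-extensive (X · Y)) γXY⊑Z))
            (λ X⊑Z⁄Y → γ-least (X · Y) Z∈L (⊑⁄⇒·⊑ X Y Z X⊑Z⁄Y))
    ; extends  = λ a b → ≐′-trans (γ-cong (↓-homo a b)) (γ-fixes-L (contains-P (a ∙ b)))
    }

module ResiduatedStructure (P : Pomonoid) (L : SubL P) (J : IsJoinCompletion P L)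
                           (R : RLStructureOn P L J) where
  open Pomonoid P
  open Ideals P
  open IsJoinCompletion J
  open RLStructureOn R
  open Equivalence

  ∈-ldiv↓ : ∀ a {B} (B∈L : L B) z → z ∈ ldiv (⇓ a) B (contains-P a) B∈L ⇔ a ∙ z ∈ B
  ∈-ldiv↓ a {B} B∈L z = mk⇔
    (λ z∈a⧵B → from (resid-l (⇓ a) (⇓ z) B (contains-P a) (contains-P z) B∈L)
                    (↓-⊑ (ldiv (⇓ a) B (contains-P a) B∈L) z∈a⧵B)
                    (a ∙ z) (proj₂ (extends a z) (a ∙ z) refl))
    (λ az∈B → to (resid-l (⇓ a) (⇓ z) B (contains-P a) (contains-P z) B∈L)
                 (⊆′-trans (proj₁ (extends a z)) (↓-⊑ B az∈B)) z refl)

  ∈-rdiv↓ : ∀ a {B} (B∈L : L B) z → z ∈ rdiv B (⇓ a) B∈L (contains-P a) ⇔ z ∙ a ∈ B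
  ∈-rdiv↓ a {B} B∈L z = mk⇔
    (λ z∈B⁄a → from (resid-r (⇓ z) (⇓ a) B (contains-P z) (contains-P a) B∈L)
                    (↓-⊑ (rdiv B (⇓ a) B∈L (contains-P a)) z∈B⁄a)
                    (z ∙ a) (proj₂ (extends z a) (z ∙ a) refl))
    (λ za∈B → to (resid-r (⇓ z) (⇓ a) B (contains-P z) (contains-P a) B∈L)
                 (⊆′-trans (proj₁ (extends z a)) (↓-⊑ B za∈B)) z refl)

  ldiv↓≋⧵ : ∀ a {B} (B∈L : L B) → ldiv (⇓ a) B (contains-P a) B∈L ≋ ⇓ a ⧵ B
  ldiv↓≋⧵ a {B} B∈L =
      (λ z z∈ldiv x x≤a → ∈-down B (∙-mono x≤a refl) (to (∈-ldiv↓ a B∈L z) z∈ldiv))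
    , (λ z z∈a⧵B → from (∈-ldiv↓ a B∈L z) (z∈a⧵B a refl))

  rdiv↓≋⁄ : ∀ a {B} (B∈L : L B) → rdiv B (⇓ a) B∈L (contains-P a) ≋ B ⁄ ⇓ a
  rdiv↓≋⁄ a {B} B∈L =
      (λ z z∈rdiv x x≤a → ∈-down B (∙-mono refl x≤a) (to (∈-rdiv↓ a B∈L z) z∈rdiv))
    , (λ z z∈B⁄a → from (∈-rdiv↓ a B∈L z) (z∈B⁄a a refl))

  cond-ii : Cond-ii P L
  cond-ii a B B∈L = respects (ldiv↓≋⧵ a B∈L) (ldiv-L (⇓ a) B (contains-P a) B∈L)
                  , respects (rdiv↓≋⁄ a B∈L) (rdiv-L B (⇓ a) B∈L (contains-P a))

  mul-monoˡ : ∀ {X X′ Y} (X∈L : L X) (X′∈L : L X′) (Y∈L : L Y) →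
              X ⊑ X′ → mul X Y X∈L Y∈L ⊑ mul X′ Y X′∈L Y∈L
  mul-monoˡ {X} {X′} {Y} X∈L X′∈L Y∈L X⊑X′ =
    from (resid-r X Y (mul X′ Y X′∈L Y∈L) X∈L Y∈L (mul-L X′ Y X′∈L Y∈L))
      (⊆′-trans X⊑X′ (to (resid-r X′ Y _ X′∈L Y∈L (mul-L X′ Y X′∈L Y∈L)) ⊆′-refl))

  mul-monoʳ : ∀ {X Y Y′} (X∈L : L X) (Y∈L : L Y) (Y′∈L : L Y′) →
              Y ⊑ Y′ → mul X Y X∈L Y∈L ⊑ mul X Y′ X∈L Y′∈L
  mul-monoʳ {X} {Y} {Y′} X∈L Y∈L Y′∈L Y⊑Y′ =
    from (resid-l X Y (mul X Y′ X∈L Y′∈L) X∈L Y∈L (mul-L X Y′ X∈L Y′∈L))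
      (⊆′-trans Y⊑Y′ (to (resid-l X Y′ _ X∈L Y′∈L (mul-L X Y′ X∈L Y′∈L)) ⊆′-refl))

  mul-isLeastAbove : ∀ X Y (X∈L : L X) (Y∈L : L Y) → IsLeastAbove P L (X · Y) (mul X Y X∈L Y∈L)
  mul-isLeastAbove X Y X∈L Y∈L = mul-L X Y X∈L Y∈L , X·Y⊑mul , mul-least
    where
    X·Y⊑mul : X · Y ⊑ mul X Y X∈L Y∈L
    X·Y⊑mul w (x , y , x∈X , y∈Y , w≤xy) =
      mul-monoʳ X∈L (contains-P y) Y∈L (↓-⊑ Y y∈Y) w
        (mul-monoˡ (contains-P x) X∈L (contains-P y) (↓-⊑ X x∈X) w
          (proj₂ (extends x y) w w≤xy))

    -- Residuating twice reduces the claim to mul (↓x) (↓y) = ↓(xy) ⊆ D for x ∈ X, y ∈ Y.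
    mul-least : ∀ D → L D → X · Y ⊑ D → mul X Y X∈L Y∈L ⊑ D
    mul-least D D∈L X·Y⊑D = from (resid-r X Y D X∈L Y∈L D∈L) λ x x∈X →
      to (resid-r (⇓ x) Y D (contains-P x) Y∈L D∈L)
        (from (resid-l (⇓ x) Y D (contains-P x) Y∈L D∈L) λ y y∈Y →
          to (resid-l (⇓ x) (⇓ y) D (contains-P x) (contains-P y) D∈L)
            (⊆′-trans (proj₁ (extends x y)) (↓-⊑ D (X·Y⊑D (x ∙ y) (x , y , x∈X , y∈Y , refl))))
            y refl)
        x refl

  preservesResidualsAndMeets : PreservesResidualsAndMeets P L J R
  preservesResidualsAndMeets =
      (λ a b c c-res → ≐′-trans (↓-preserves-⧵ c-res) (≐′-sym (ldiv↓≋⧵ a (contains-P b))))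
    , (λ b a c c-res → ≐′-trans (↓-preserves-⁄ c-res) (≐′-sym (rdiv↓≋⁄ a (contains-P b))))
    , Completion.↓-preserves-meets P L J

multiplication-unique : (P : Pomonoid) (L : SubL P) (J : IsJoinCompletion P L)
                        (R₁ R₂ : RLStructureOn P L J) → SameMultiplication P L J R₁ R₂
multiplication-unique P L J R₁ R₂ X Y X∈L Y∈L =
  leastAbove-unique (X · Y) (R₁.mul-isLeastAbove X Y X∈L Y∈L) (R₂.mul-isLeastAbove X Y X∈L Y∈L)
  where
  open Ideals P using (_·_; leastAbove-unique)
  module R₁ = ResiduatedStructure P L J R₁
  module R₂ = ResiduatedStructure P L J R₂

theorem3p5 : (P : Pomonoid) (L : SubL P) (J : IsJoinCompletion P L) →
    (RLStructureOn P L J ⇔ Cond-ii P L)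
    × (RLStructureOn P L J ⇔ IsNucleusSystem P L)
    × (RLStructureOn P L J ⇔ Cond-iv P L)
    × (∀ (R₁ R₂ : RLStructureOn P L J) → SameMultiplication P L J R₁ R₂)
    × (∀ (R : RLStructureOn P L J) → PreservesResidualsAndMeets P L J R)
theorem3p5 P L J =
    mk⇔ i⇒ii (λ ii → iv⇒i (iii⇒iv (ii⇒iii ii)))
  , mk⇔ (λ R → ii⇒iii (i⇒ii R)) (λ iii → iv⇒i (iii⇒iv iii))
  , mk⇔ (λ R → iii⇒iv (ii⇒iii (i⇒ii R))) iv⇒i
  , multiplication-unique P L J
  , ResiduatedStructure.preservesResidualsAndMeets P L J
  where
  i⇒ii : RLStructureOn P L J → Cond-ii P L
  i⇒ii = ResiduatedStructure.cond-ii P L J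

  ii⇒iii : Cond-ii P L → IsNucleusSystem P L
  ii⇒iii = Completion.Cond-ii⇒IsNucleusSystem P L J

  iii⇒iv : IsNucleusSystem P L → Cond-iv P L
  iii⇒iv (closure , closed) =
    γ , γ-closure , ClosureOperator.residualClosed⇒isNucleus P L γ γ-closure closed
    where
    γ : DS P → DS P
    γ X = proj₁ (closure X)

    γ-closure : IsClosureOperatorOf P L γ
    γ-closure X = proj₂ (closure X)

  iv⇒i : Cond-iv P L → RLStructureOn P L J
  iv⇒i (γ , γ-closure , nucleus) = NucleusStructure.residuatedLattice P L J γ γ-closure nucleus
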